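{- Let $(R, \mathfrak m)$ be a Noetherian local ring, $\mathfrak b \subseteq R$ an ideal, and $\mathfrak a := \mathfrak m \mathfrak b$. If $G$ is a finitely generated $R/\mathfrak a$-module with $\mathfrak b G = 0$, and $M$ is a finitely generated $R$-module with $M/\mathfrak a M \simeq_R G$, then $\mathfrak a M = 0$, so that $M \simeq_R G$. -}

module Defs where

open import Level using (Level; _⊔_)
open import Data.Nat using (ℕ)
open import Data.Vec using (Vec; []; _∷_)
open import Data.Vec.Relation.Unary.All using (All)
open import Data.Product using (Σ; ∃; _×_; _,_)
open import Relation.Nullary using (¬_)
open import Relation.Unary using (Pred)
open import Relation.Binary using (Rel)
open import Algebra.Bundles using (CommutativeRing)
open import Algebra.Module.Bundles using (Module)

private variable c ℓ cm ℓm cn ℓn ℓ' : Level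

module _ (R : CommutativeRing c ℓ) where
  open CommutativeRing R

  IdealPred : Set _
  IdealPred = Pred Carrier (c ⊔ ℓ)

  record IsIdeal (I : IdealPred) : Set (c ⊔ ℓ) where
    field
      resp  : ∀ {x y} → x ≈ y → I x → I y
      zero∈ : I 0#
      +∈    : ∀ {x y} → I x → I y → I (x + y)
      *∈    : ∀ r {x} → I x → I (r * x)

  lin : ∀ {n} → Vec Carrier n → Vec Carrier n → Carrier
  lin []       []       = 0#
  lin (r ∷ rs) (g ∷ gs) = r * g + lin rs gs

  FinitelyGeneratedIdeal : IdealPred → Set (c ⊔ ℓ)
  FinitelyGeneratedIdeal I =
    ∃ λ n → Σ (Vec Carrier n) λ gs → All I gs ×
      (∀ x → I x → Σ (Vec Carrier n) λ cs → x ≈ lin cs gs)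

  Noetherian : Set (Level.suc (c ⊔ ℓ))
  Noetherian = ∀ (I : IdealPred) → IsIdeal I → FinitelyGeneratedIdeal I

  Unit : Carrier → Set (c ⊔ ℓ)
  Unit x = ∃ λ y → x * y ≈ 1#

  IsLocal : IdealPred → Set (c ⊔ ℓ)
  IsLocal m = IsIdeal m × ¬ m 1# × (∀ x → ¬ m x → Unit x)

  _·ᴵ_ : IdealPred → IdealPred → IdealPred
  (I ·ᴵ J) x = ∃ λ n → Σ (Vec Carrier n) λ as → Σ (Vec Carrier n) λ bs →
    All I as × All J bs × x ≈ lin as bs

module _ {R : CommutativeRing c ℓ} (M : Module R cm ℓm) where
  open CommutativeRing R
  open Module M

  linᴹ : ∀ {n} → Vec Carrier n → Vec Carrierᴹ n → Carrierᴹ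
  linᴹ []       []       = 0ᴹ
  linᴹ (r ∷ rs) (x ∷ xs) = r *ₗ x +ᴹ linᴹ rs xs

  FinitelyGeneratedModule : Set (c ⊔ cm ⊔ ℓm)
  FinitelyGeneratedModule =
    ∃ λ n → Σ (Vec Carrierᴹ n) λ gs →
      ∀ x → Σ (Vec Carrier n) λ cs → x ≈ᴹ linᴹ cs gs

  _·ᴹ : IdealPred R → Pred Carrierᴹ (c ⊔ ℓ ⊔ cm ⊔ ℓm)
  (I ·ᴹ) x = ∃ λ n → Σ (Vec Carrier n) λ as → Σ (Vec Carrierᴹ n) λ xs →
    All I as × x ≈ᴹ linᴹ as xs

  -- congruence modulo I M (the equality of M / I M)
  _≡[_]_ : Carrierᴹ → IdealPred R → Carrierᴹ → Set (c ⊔ ℓ ⊔ cm ⊔ ℓm)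
  x ≡[ I ] y = (I ·ᴹ) (x +ᴹ (-ᴹ y))

  KillsSubmodule : IdealPred R → Set (c ⊔ ℓ ⊔ cm ⊔ ℓm)
  KillsSubmodule I = ∀ x → (I ·ᴹ) x → x ≈ᴹ 0ᴹ

  Annihilates : IdealPred R → Set (c ⊔ ℓ ⊔ cm ⊔ ℓm)
  Annihilates I = ∀ r x → I r → r *ₗ x ≈ᴹ 0ᴹ

-- An R-module isomorphism (Carrierᴹ M / ∼) ≅ N, where ∼ is a congruence on M
-- (∼ = ≈ᴹ gives M ≅ N;  ∼ = ≡[ I ] gives M / I M ≅ N).
record IsoVia {R : CommutativeRing c ℓ} (M : Module R cm ℓm) (N : Module R cn ℓn)
              (_∼_ : Rel (Module.Carrierᴹ M) ℓ')
              : Set (c ⊔ cm ⊔ ℓm ⊔ cn ⊔ ℓn ⊔ ℓ') where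
  private
    module M = Module M
    module N = Module N
  open CommutativeRing R using (Carrier)
  field
    to       : M.Carrierᴹ → N.Carrierᴹ
    from     : N.Carrierᴹ → M.Carrierᴹ
    to-cong  : ∀ {x y} → x ∼ y → to x N.≈ᴹ to y
    from-cong : ∀ {u v} → u N.≈ᴹ v → from u ∼ from v
    to-+     : ∀ x y → to (x M.+ᴹ y) N.≈ᴹ (to x N.+ᴹ to y)
    to-*     : ∀ (r : Carrier) x → to (r M.*ₗ x) N.≈ᴹ (r N.*ₗ to x)
    to-from  : ∀ u → to (from u) N.≈ᴹ u
    from-to  : ∀ x → from (to x) ∼ x

_≅ᴹ_ : {R : CommutativeRing c ℓ} → Module R cm ℓm → Module R cn ℓn → Set _
M ≅ᴹ N = IsoVia M N (Module._≈ᴹ_ M)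

QuotIso : {R : CommutativeRing c ℓ} (M : Module R cm ℓm) → IdealPred R → Module R cn ℓn → Set _
QuotIso M I N = IsoVia M N (λ x y → _≡[_]_ M x I y)

-- Let b₁ … b_p generate 𝔟 and g₁ … g_q generate M.  The submodule 𝔟M is generated by the
-- products bᵢ gⱼ.  Since 𝔟 kills G ≅ M/𝔞M, each bᵢ gⱼ lies in 𝔞M = 𝔪(𝔟M), so the generators
-- of 𝔟M all lie in 𝔪(𝔟M).  Nakayama's lemma, in the constructive form that eliminates one
-- generator at a time (y = m y + z with m ∈ 𝔪 gives y = (1 - m)⁻¹ z), shows 𝔟M = 0, hence
-- 𝔞M ⊆ 𝔟M is zero and the isomorphism M/𝔞M ≅ G is already an isomorphism M ≅ G.
module Submission where

open import Defs
open import Level using (Level; _⊔_)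
open import Data.Product using (_×_; _,_; ∃; proj₁)
open import Data.Unit.Polymorphic using (tt)
open import Data.List using (List; _∷_; cartesianProductWith)
open import Data.List.Membership.Propositional using () renaming (_∈_ to _∈ₗ_)
open import Data.List.Membership.Propositional.Properties
  using (∈-cartesianProductWith⁺; ∈-cartesianProductWith⁻)
open import Data.List.Relation.Unary.Any using (here; there)
open import Data.Vec using (Vec; []; _∷_; _++_; toList; map)
open import Data.Vec.Membership.Propositional using (_∈_)
open import Data.Vec.Membership.Propositional.Properties using (∈-toList⁺; ∈-toList⁻)
open import Data.Vec.Relation.Unary.All as All using (All; []; _∷_)
open import Data.Vec.Relation.Unary.All.Properties using (++⁺)
import Data.Vec.Relation.Unary.Any as VecAny
open import Relation.Binary.PropositionalEquality using (refl)
open import Relation.Unary using (Pred; _⊆_)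
open import Relation.Unary.Polymorphic using (U)
open import Algebra.Bundles using (CommutativeRing; AbelianGroup)
open import Algebra.Module.Bundles using (Module)
import Algebra.Properties.AbelianGroup as AbelianGroupProperties
import Algebra.Properties.CommutativeSemigroup as CommutativeSemigroupProperties
import Algebra.Module.Properties as ModuleProperties
import Relation.Binary.Reasoning.Setoid as SetoidReasoning

private variable c ℓ cm ℓm cn ℓn : Level

module _ {R : CommutativeRing c ℓ} where
  open CommutativeRing R

  U-isIdeal : IsIdeal R U
  U-isIdeal = record { resp = λ _ _ → tt ; zero∈ = tt ; +∈ = λ _ _ → tt ; *∈ = λ _ _ → tt }

  [1-m]+m≈1 : ∀ m → (1# - m) + m ≈ 1#
  [1-m]+m≈1 m = //-rightDividesˡ m 1#
    where open AbelianGroupProperties +-abelianGroup using (//-rightDividesˡ)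

  m∈𝔪⇒Unit[1-m] : ∀ {𝔪 m} → IsLocal R 𝔪 → 𝔪 m → Unit R (1# - m)
  m∈𝔪⇒Unit[1-m] {m = m} (𝔪-ideal , 1∉𝔪 , nonmember⇒unit) m∈𝔪 =
    nonmember⇒unit (1# - m) λ 1-m∈𝔪 → 1∉𝔪 (resp ([1-m]+m≈1 m) (+∈ 1-m∈𝔪 m∈𝔪))
    where open IsIdeal 𝔪-ideal

module _ {R : CommutativeRing c ℓ} (M : Module R cm ℓm) where
  open CommutativeRing R hiding (refl)
  open Module M
  open ModuleProperties M using (inverseˡ-uniqueᴹ; y≈0⇒x*y≈0)
  open AbelianGroupProperties +ᴹ-abelianGroup
    using (ε⁻¹≈ε; ⁻¹-∙-comm; ⁻¹-anti-homo‿-; //-rightDividesˡ; x≈y⇒x∙y⁻¹≈ε; x∙y⁻¹≈ε⇒x≈y; ∙-cancelˡ)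
  open CommutativeSemigroupProperties (AbelianGroup.commutativeSemigroup +ᴹ-abelianGroup)
    using (interchange)
  open SetoidReasoning ≈ᴹ-setoid

  private
    _·M : IdealPred R → Pred Carrierᴹ (c ⊔ ℓ ⊔ cm ⊔ ℓm)
    I ·M = _·ᴹ M I

    _≡[_]M_ : Carrierᴹ → IdealPred R → Carrierᴹ → Set (c ⊔ ℓ ⊔ cm ⊔ ℓm)
    x ≡[ I ]M y = _≡[_]_ M x I y

  -ᴹ-*ₗ : ∀ r x → -ᴹ (r *ₗ x) ≈ᴹ r *ₗ (-ᴹ x)
  -ᴹ-*ₗ r x = ≈ᴹ-sym (inverseˡ-uniqueᴹ _ _ (begin
    r *ₗ (-ᴹ x) +ᴹ r *ₗ x ≈⟨ *ₗ-distribˡ r (-ᴹ x) x ⟨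
    r *ₗ (-ᴹ x +ᴹ x)      ≈⟨ *ₗ-congˡ (-ᴹ‿inverseˡ x) ⟩
    r *ₗ 0ᴹ               ≈⟨ *ₗ-zeroʳ r ⟩
    0ᴹ                    ∎))

  linᴹ-++ : ∀ {m n} (as : Vec Carrier m) xs (bs : Vec Carrier n) ys →
            linᴹ M (as ++ bs) (xs ++ ys) ≈ᴹ linᴹ M as xs +ᴹ linᴹ M bs ys
  linᴹ-++ []       []       bs ys = ≈ᴹ-sym (+ᴹ-identityˡ _)
  linᴹ-++ (a ∷ as) (x ∷ xs) bs ys = ≈ᴹ-trans (+ᴹ-congˡ (linᴹ-++ as xs bs ys)) (≈ᴹ-sym (+ᴹ-assoc _ _ _))

  -ᴹ-linᴹ : ∀ {n} (as : Vec Carrier n) xs → -ᴹ linᴹ M as xs ≈ᴹ linᴹ M as (map -ᴹ_ xs)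
  -ᴹ-linᴹ []       []       = ε⁻¹≈ε
  -ᴹ-linᴹ (a ∷ as) (x ∷ xs) = begin
    -ᴹ (a *ₗ x +ᴹ linᴹ M as xs)          ≈⟨ ⁻¹-∙-comm _ _ ⟨
    -ᴹ (a *ₗ x) +ᴹ -ᴹ linᴹ M as xs       ≈⟨ +ᴹ-cong (-ᴹ-*ₗ a x) (-ᴹ-linᴹ as xs) ⟩
    a *ₗ (-ᴹ x) +ᴹ linᴹ M as (map -ᴹ_ xs) ∎

  module _ {I : IdealPred R} where

    ·ᴹ-resp : ∀ {x y} → x ≈ᴹ y → (I ·M) x → (I ·M) y
    ·ᴹ-resp x≈y (n , as , xs , I-as , x≈) = n , as , xs , I-as , ≈ᴹ-trans (≈ᴹ-sym x≈y) x≈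

    ·ᴹ-+ᴹ : ∀ {x y} → (I ·M) x → (I ·M) y → (I ·M) (x +ᴹ y)
    ·ᴹ-+ᴹ (n , as , xs , I-as , x≈) (k , bs , ys , I-bs , y≈) =
      _ , as ++ bs , xs ++ ys , ++⁺ I-as I-bs ,
      ≈ᴹ-trans (+ᴹ-cong x≈ y≈) (≈ᴹ-sym (linᴹ-++ as xs bs ys))

    ·ᴹ--ᴹ : ∀ {x} → (I ·M) x → (I ·M) (-ᴹ x)
    ·ᴹ--ᴹ (n , as , xs , I-as , x≈) = n , as , map -ᴹ_ xs , I-as , ≈ᴹ-trans (-ᴹ‿cong x≈) (-ᴹ-linᴹ as xs)

    ≡[]-reflexive : ∀ {x y} → x ≈ᴹ y → x ≡[ I ]M y
    ≡[]-reflexive x≈y = ·ᴹ-resp (≈ᴹ-sym (x≈y⇒x∙y⁻¹≈ε x≈y)) (0 , [] , [] , [] , ≈ᴹ-refl)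

    ≡[]-sym : ∀ {x y} → x ≡[ I ]M y → y ≡[ I ]M x
    ≡[]-sym {x} {y} x≡y = ·ᴹ-resp (⁻¹-anti-homo‿- x y) (·ᴹ--ᴹ x≡y)

    ≡[]-trans : ∀ {x y z} → x ≡[ I ]M y → y ≡[ I ]M z → x ≡[ I ]M z
    ≡[]-trans {x} {y} {z} x≡y y≡z = ·ᴹ-resp (begin
      (x +ᴹ -ᴹ y) +ᴹ (y +ᴹ -ᴹ z) ≈⟨ +ᴹ-assoc _ y (-ᴹ z) ⟨
      ((x +ᴹ -ᴹ y) +ᴹ y) +ᴹ -ᴹ z ≈⟨ +ᴹ-congʳ (//-rightDividesˡ y x) ⟩
      x +ᴹ -ᴹ z                  ∎) (·ᴹ-+ᴹ x≡y y≡z)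

    ≡[]0⇒·ᴹ : ∀ {x} → x ≡[ I ]M 0ᴹ → (I ·M) x
    ≡[]0⇒·ᴹ = ·ᴹ-resp (≈ᴹ-trans (+ᴹ-congˡ ε⁻¹≈ε) (+ᴹ-identityʳ _))

  module _ {N : Module R cn ℓn} {I : IdealPred R} (iso : QuotIso M I N) where
    private module N = Module N
    open IsoVia iso

    to-injective : ∀ {x y} → to x N.≈ᴹ to y → x ≡[ I ]M y
    to-injective {x} {y} tx≈ty = ≡[]-trans (≡[]-sym (from-to x)) (≡[]-trans (from-cong tx≈ty) (from-to y))

    Annihilates⇒·ᴹ : ∀ {J} → Annihilates N J → ∀ {b} → J b → ∀ x → (I ·M) (b *ₗ x)
    Annihilates⇒·ᴹ J-kills {b} b∈J x = ≡[]0⇒·ᴹ (to-injective (N.≈ᴹ-trans (to-* b x)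
      (N.≈ᴹ-trans (J-kills b (to x) b∈J) (N.≈ᴹ-sym to-0ᴹ))))
      where
      to-0ᴹ : to 0ᴹ N.≈ᴹ N.0ᴹ
      to-0ᴹ = N.≈ᴹ-trans (to-cong (≡[]-reflexive (≈ᴹ-sym (*ₗ-zeroˡ 0ᴹ))))
                (N.≈ᴹ-trans (to-* 0# 0ᴹ) (N.*ₗ-zeroˡ _))

    QuotIso⇒≅ᴹ : KillsSubmodule M I → M ≅ᴹ N
    QuotIso⇒≅ᴹ IM≈0 = record
      { to = to ; from = from
      ; to-cong = λ x≈y → to-cong (≡[]-reflexive x≈y)
      ; from-cong = λ u≈v → ≡[]⇒≈ (from-cong u≈v)
      ; to-+ = to-+ ; to-* = to-* ; to-from = to-from
      ; from-to = λ x → ≡[]⇒≈ (from-to x)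
      }
      where
      ≡[]⇒≈ : ∀ {x y} → x ≡[ I ]M y → x ≈ᴹ y
      ≡[]⇒≈ x≡y = x∙y⁻¹≈ε⇒x≈y _ _ (IM≈0 _ x≡y)

  -- For an ideal P this is the submodule P⟨ys⟩; in particular U⟨ys⟩ is the span of ys.
  data LinComb (P : IdealPred R) (ys : List Carrierᴹ) : Pred Carrierᴹ (c ⊔ ℓ ⊔ cm ⊔ ℓm) where
    gen   : ∀ {r y} → P r → y ∈ₗ ys → LinComb P ys (r *ₗ y)
    zero∈ : LinComb P ys 0ᴹ
    +∈    : ∀ {x y} → LinComb P ys x → LinComb P ys y → LinComb P ys (x +ᴹ y)
    resp  : ∀ {x y} → x ≈ᴹ y → LinComb P ys x → LinComb P ys y

  module _ {P Q : IdealPred R} {ys : List Carrierᴹ} where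

    LinComb-*ₗ : ∀ s → (∀ {r} → P r → Q (s * r)) → ∀ {x} → LinComb P ys x → LinComb Q ys (s *ₗ x)
    LinComb-*ₗ s sP⊆Q (gen {r} {y} r∈P y∈ys) = resp (*ₗ-assoc s r y) (gen (sP⊆Q r∈P) y∈ys)
    LinComb-*ₗ s sP⊆Q zero∈                  = resp (≈ᴹ-sym (*ₗ-zeroʳ s)) zero∈
    LinComb-*ₗ s sP⊆Q (+∈ x∈ y∈)             =
      resp (≈ᴹ-sym (*ₗ-distribˡ s _ _)) (+∈ (LinComb-*ₗ s sP⊆Q x∈) (LinComb-*ₗ s sP⊆Q y∈))
    LinComb-*ₗ s sP⊆Q (resp x≈y x∈)          = resp (*ₗ-congˡ x≈y) (LinComb-*ₗ s sP⊆Q x∈)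

  LinComb-scale : ∀ {P ys} → IsIdeal R P → ∀ s {x} → LinComb P ys x → LinComb P ys (s *ₗ x)
  LinComb-scale P-ideal s = LinComb-*ₗ s (IsIdeal.*∈ P-ideal s)

  LinComb-≈0 : ∀ {P ys} → (∀ {y} → y ∈ₗ ys → y ≈ᴹ 0ᴹ) → ∀ {x} → LinComb P ys x → x ≈ᴹ 0ᴹ
  LinComb-≈0 ys≈0 (gen _ y∈ys)  = y≈0⇒x*y≈0 (ys≈0 y∈ys)
  LinComb-≈0 ys≈0 zero∈         = ≈ᴹ-refl
  LinComb-≈0 ys≈0 (+∈ x∈ y∈)    = ≈ᴹ-trans (+ᴹ-cong (LinComb-≈0 ys≈0 x∈) (LinComb-≈0 ys≈0 y∈)) (+ᴹ-identityˡ _)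
  LinComb-≈0 ys≈0 (resp x≈y x∈) = ≈ᴹ-trans (≈ᴹ-sym x≈y) (LinComb-≈0 ys≈0 x∈)

  ·ᴹ⊆LinComb : ∀ {I Q ys} → (∀ {a} x → I a → LinComb Q ys (a *ₗ x)) → (I ·M) ⊆ LinComb Q ys
  ·ᴹ⊆LinComb {I} {Q} {ys} Ix⊆ (n , as , xs , I-as , x≈) = resp (≈ᴹ-sym x≈) (linᴹ∈ I-as xs)
    where
    linᴹ∈ : ∀ {k} {as : Vec Carrier k} → All I as → ∀ xs → LinComb Q ys (linᴹ M as xs)
    linᴹ∈ []            []       = zero∈
    linᴹ∈ (a∈I ∷ I-as) (x ∷ xs) = +∈ (Ix⊆ x a∈I) (linᴹ∈ I-as xs)

  module _ {P : IdealPred R} (P-ideal : IsIdeal R P) where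
    open IsIdeal P-ideal using () renaming (zero∈ to 0∈P; +∈ to +∈P)

    LinComb-uncons : ∀ {y ys x} → LinComb P (y ∷ ys) x →
                     ∃ λ r → P r × ∃ λ z → LinComb P ys z × x ≈ᴹ r *ₗ y +ᴹ z
    LinComb-uncons (gen r∈P (here refl)) = _ , r∈P , 0ᴹ , zero∈ , ≈ᴹ-sym (+ᴹ-identityʳ _)
    LinComb-uncons {y} (gen {r} {y′} r∈P (there y′∈ys)) =
      0# , 0∈P , r *ₗ y′ , gen r∈P y′∈ys ,
      ≈ᴹ-trans (≈ᴹ-sym (+ᴹ-identityˡ _)) (+ᴹ-congʳ (≈ᴹ-sym (*ₗ-zeroˡ y)))
    LinComb-uncons {y} zero∈ = 0# , 0∈P , 0ᴹ , zero∈ , ≈ᴹ-sym (≈ᴹ-trans (+ᴹ-identityʳ _) (*ₗ-zeroˡ y))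
    LinComb-uncons {y} (+∈ {x₁} {x₂} x₁∈ x₂∈)
      with r₁ , r₁∈P , z₁ , z₁∈ , x₁≈ ← LinComb-uncons x₁∈
         | r₂ , r₂∈P , z₂ , z₂∈ , x₂≈ ← LinComb-uncons x₂∈ =
      r₁ + r₂ , +∈P r₁∈P r₂∈P , z₁ +ᴹ z₂ , +∈ z₁∈ z₂∈ , (begin
        x₁ +ᴹ x₂                            ≈⟨ +ᴹ-cong x₁≈ x₂≈ ⟩
        (r₁ *ₗ y +ᴹ z₁) +ᴹ (r₂ *ₗ y +ᴹ z₂) ≈⟨ interchange _ _ _ _ ⟩
        (r₁ *ₗ y +ᴹ r₂ *ₗ y) +ᴹ (z₁ +ᴹ z₂) ≈⟨ +ᴹ-congʳ (*ₗ-distribʳ y r₁ r₂) ⟨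
        (r₁ + r₂) *ₗ y +ᴹ (z₁ +ᴹ z₂)       ∎)
    LinComb-uncons (resp x≈y x∈) with r , r∈P , z , z∈ , x≈ ← LinComb-uncons x∈ =
      r , r∈P , z , z∈ , ≈ᴹ-trans (≈ᴹ-sym x≈y) x≈

    LinComb-substitute : ∀ {y ys x} → LinComb P ys y → LinComb P (y ∷ ys) x → LinComb P ys x
    LinComb-substitute y∈ (gen {r} _ (here refl)) = LinComb-scale P-ideal r y∈
    LinComb-substitute y∈ (gen r∈P (there y′∈ys)) = gen r∈P y′∈ys
    LinComb-substitute y∈ zero∈                   = zero∈
    LinComb-substitute y∈ (+∈ x₁∈ x₂∈)            = +∈ (LinComb-substitute y∈ x₁∈) (LinComb-substitute y∈ x₂∈)
    LinComb-substitute y∈ (resp x≈y x∈)           = resp x≈y (LinComb-substitute y∈ x∈)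

  module _ {𝔪 : IdealPred R} (local : IsLocal R 𝔪) where
    private 𝔪-ideal = proj₁ local

    redundant-generator : ∀ {y ys} → LinComb 𝔪 (y ∷ ys) y → LinComb 𝔪 ys y
    redundant-generator {y} y∈
      with m , m∈𝔪 , z , z∈ , y≈my+z ← LinComb-uncons 𝔪-ideal y∈
      with v , [1-m]v≈1 ← m∈𝔪⇒Unit[1-m] local m∈𝔪 =
      resp vz≈y (LinComb-scale 𝔪-ideal v z∈)
      where
      [1-m]y≈z : (1# - m) *ₗ y ≈ᴹ z
      [1-m]y≈z = ∙-cancelˡ (m *ₗ y) _ z (begin
        m *ₗ y +ᴹ (1# - m) *ₗ y ≈⟨ +ᴹ-comm _ _ ⟩
        (1# - m) *ₗ y +ᴹ m *ₗ y ≈⟨ *ₗ-distribʳ y (1# - m) m ⟨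
        ((1# - m) + m) *ₗ y     ≈⟨ *ₗ-congʳ ([1-m]+m≈1 {R = R} m) ⟩
        1# *ₗ y                 ≈⟨ *ₗ-identityˡ y ⟩
        y                       ≈⟨ y≈my+z ⟩
        m *ₗ y +ᴹ z             ∎)
      vz≈y : v *ₗ z ≈ᴹ y
      vz≈y = begin
        v *ₗ z                  ≈⟨ *ₗ-congˡ [1-m]y≈z ⟨
        v *ₗ ((1# - m) *ₗ y)    ≈⟨ *ₗ-assoc v (1# - m) y ⟨
        (v * (1# - m)) *ₗ y     ≈⟨ *ₗ-congʳ (trans (*-comm v _) [1-m]v≈1) ⟩
        1# *ₗ y                 ≈⟨ *ₗ-identityˡ y ⟩
        y                       ∎

    nakayama : ∀ ys → (∀ {y} → y ∈ₗ ys → LinComb 𝔪 ys y) → ∀ {y} → y ∈ₗ ys → y ≈ᴹ 0ᴹ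
    nakayama (y ∷ ys) ys⊆𝔪⟨ys⟩ = λ where
        (here refl)  → LinComb-≈0 rest≈0 y∈𝔪⟨rest⟩
        (there w∈ys) → rest≈0 w∈ys
      where
      y∈𝔪⟨rest⟩ : LinComb 𝔪 ys y
      y∈𝔪⟨rest⟩ = redundant-generator (ys⊆𝔪⟨ys⟩ (here refl))
      rest≈0 : ∀ {w} → w ∈ₗ ys → w ≈ᴹ 0ᴹ
      rest≈0 = nakayama ys λ w∈ys → LinComb-substitute 𝔪-ideal y∈𝔪⟨rest⟩ (ys⊆𝔪⟨ys⟩ (there w∈ys))

  module _ {ys : List Carrierᴹ} where

    lin-*ₗ∈ : ∀ {I n} {as bs : Vec Carrier n} {x} → IsIdeal R I → All I as →
              (∀ {b} → b ∈ bs → LinComb U ys (b *ₗ x)) → LinComb I ys (lin R as bs *ₗ x)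
    lin-*ₗ∈ {as = []}    {[]}    {x} _ _ _ = resp (≈ᴹ-sym (*ₗ-zeroˡ x)) zero∈
    lin-*ₗ∈ {as = a ∷ as} {b ∷ bs} {x} I-ideal (a∈I ∷ I-as) bs-x∈ =
      resp (≈ᴹ-sym (≈ᴹ-trans (*ₗ-distribʳ x _ _) (+ᴹ-congʳ (*ₗ-assoc a b x))))
        (+∈ (LinComb-*ₗ a (λ {r} _ → IsIdeal.resp I-ideal (*-comm r a) (IsIdeal.*∈ I-ideal r a∈I))
                        (bs-x∈ (VecAny.here refl)))
            (lin-*ₗ∈ I-ideal I-as (λ b∈bs → bs-x∈ (VecAny.there b∈bs))))

    *ₗ-linᴹ∈ : ∀ {n} b (ds : Vec Carrier n) gs → (∀ {g} → g ∈ gs → LinComb U ys (b *ₗ g)) →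
               LinComb U ys (b *ₗ linᴹ M ds gs)
    *ₗ-linᴹ∈ b []       []       _      = resp (≈ᴹ-sym (*ₗ-zeroʳ b)) zero∈
    *ₗ-linᴹ∈ b (d ∷ ds) (g ∷ gs) b-gs∈ =
      resp (≈ᴹ-sym (≈ᴹ-trans (*ₗ-distribˡ b _ _) (+ᴹ-congʳ (*ₗ-comm b d g))))
        (+∈ (LinComb-scale U-isIdeal d (b-gs∈ (VecAny.here refl)))
            (*ₗ-linᴹ∈ b ds gs (λ g∈gs → b-gs∈ (VecAny.there g∈gs))))

    ·ᴵ-*ₗ∈ : ∀ {I J a x} → IsIdeal R I → (∀ {b} → J b → LinComb U ys (b *ₗ x)) →
             _·ᴵ_ R I J a → LinComb I ys (a *ₗ x)
    ·ᴵ-*ₗ∈ I-ideal Jx⊆ (_ , as , bs , I-as , J-bs , a≈) =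
      resp (*ₗ-congʳ (sym a≈)) (lin-*ₗ∈ I-ideal I-as λ b∈bs → Jx⊆ (All.lookup J-bs b∈bs))

  products : ∀ {p q} → Vec Carrier p → Vec Carrierᴹ q → List Carrierᴹ
  products bs gs = cartesianProductWith _*ₗ_ (toList bs) (toList gs)

  *ₗ∈span-products : ∀ {p q} (bs : Vec Carrier p) (gs : Vec Carrierᴹ q) {b x} →
                     (∃ λ cs → b ≈ lin R cs bs) → (∃ λ ds → x ≈ᴹ linᴹ M ds gs) →
                     LinComb U (products bs gs) (b *ₗ x)
  *ₗ∈span-products bs gs (cs , b≈) (ds , x≈) =
    resp (≈ᴹ-sym (≈ᴹ-trans (*ₗ-congʳ b≈) (*ₗ-congˡ x≈)))
      (lin-*ₗ∈ U-isIdeal (All.universal (λ _ → tt) cs) λ bᵢ∈bs →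
        *ₗ-linᴹ∈ _ ds gs λ gⱼ∈gs →
          resp (*ₗ-identityˡ _) (gen tt (∈-cartesianProductWith⁺ _*ₗ_ (∈-toList⁺ bᵢ∈bs) (∈-toList⁺ gⱼ∈gs))))

lemma3p6 : ∀ {c ℓ cm ℓm cg ℓg : Level} (R : CommutativeRing c ℓ) → Noetherian R →
           (𝔪 : IdealPred R) → IsLocal R 𝔪 →
           (𝔟 : IdealPred R) → IsIdeal R 𝔟 →
           (G : Module R cg ℓg) → FinitelyGeneratedModule G →
           Annihilates G (_·ᴵ_ R 𝔪 𝔟) → Annihilates G 𝔟 →
           (M : Module R cm ℓm) → FinitelyGeneratedModule M →
           QuotIso M (_·ᴵ_ R 𝔪 𝔟) G →
           KillsSubmodule M (_·ᴵ_ R 𝔪 𝔟) × (M ≅ᴹ G)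
lemma3p6 R noetherian 𝔪 local 𝔟 𝔟-ideal G _ _ 𝔟-kills-G M (_ , gs , gs-span) iso
  with _ , bs , 𝔟-bs , bs-span ← noetherian 𝔟 𝔟-ideal =
  𝔞M≈0 , QuotIso⇒≅ᴹ M iso 𝔞M≈0
  where
  open Module M using (_*ₗ_)
  ys = products M bs gs
  𝔞M⊆𝔪⟨ys⟩ : _·ᴹ M (_·ᴵ_ R 𝔪 𝔟) ⊆ LinComb M 𝔪 ys
  𝔞M⊆𝔪⟨ys⟩ = ·ᴹ⊆LinComb M λ x → ·ᴵ-*ₗ∈ M (proj₁ local)
    λ b∈𝔟 → *ₗ∈span-products M bs gs (bs-span _ b∈𝔟) (gs-span x)
  ys⊆𝔪⟨ys⟩ : ∀ {y} → y ∈ₗ ys → LinComb M 𝔪 ys y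
  ys⊆𝔪⟨ys⟩ y∈ys with b , g , b∈bs , _ , refl ← ∈-cartesianProductWith⁻ _*ₗ_ _ _ y∈ys =
    𝔞M⊆𝔪⟨ys⟩ (Annihilates⇒·ᴹ M iso 𝔟-kills-G (All.lookup 𝔟-bs (∈-toList⁻ b∈bs)) g)
  𝔞M≈0 : KillsSubmodule M (_·ᴵ_ R 𝔪 𝔟)
  𝔞M≈0 _ x∈𝔞M = LinComb-≈0 M (nakayama M local ys ys⊆𝔪⟨ys⟩) (𝔞M⊆𝔪⟨ys⟩ x∈𝔞M)
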